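{- For all integers $n \geq 1$, \[ \sum_{\nu=1}^n \nu!\,\mathbf{S}_2(n,\nu)\,\mathbf{H}_\nu\,\frac{(-1)^\nu}{\nu+1} = -\frac{n}{2}\,\mathbf{B}_{n-1}. \]
   Context: $\mathbf{S}_2(n,k)$ denotes the Stirling numbers of the second kind. $\mathbf{H}_\nu = \sum_{j=1}^\nu 1/j$ is the $\nu$-th harmonic number. The Bernoulli numbers $\mathbf{B}_n$ are defined by $\frac{z}{e^z-1} = \sum_{n\ge 0} \mathbf{B}_n \frac{z^n}{n!}$ for $|z|<2\pi$. -}

module Defs where

open import Data.Nat as ℕ using (ℕ; zero; suc)
open import Data.Nat.Combinatorics using (_C_)
open import Data.Integer using (+_; -[1+_])
open import Data.Rational using (ℚ; 0ℚ; 1ℚ; _+_; _*_; -_; _/_)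
open import Data.List using (List; []; _∷_; _++_; length; lookup; reverse)
open import Data.Fin using (Fin; toℕ)
open import Data.Product using (_×_; _,_; proj₁; proj₂)
import Data.Bool

Σ< : ℕ → (ℕ → ℚ) → ℚ
Σ< zero    f = 0ℚ
Σ< (suc n) f = Σ< n f + f n

-- Σ_{i = a}^{b} f i (inclusive; empty if b < a)
Σ[_⋯_] : ℕ → ℕ → (ℕ → ℚ) → ℚ
Σ[ a ⋯ b ] f = Σ< (suc b ℕ.∸ a) (λ i → f (a ℕ.+ i))

S₂ : ℕ → ℕ → ℕ
S₂ zero    zero    = 1
S₂ zero    (suc k) = 0
S₂ (suc n) zero    = 0
S₂ (suc n) (suc k) = suc k ℕ.* S₂ n (suc k) ℕ.+ S₂ n k

H : ℕ → ℚ
H zero    = 0ℚ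
H (suc ν) = H ν + (+ 1 / suc ν)

sgn : ℕ → ℚ
sgn zero    = 1ℚ
sgn (suc ν) = - sgn ν

-- Bernoulli numbers from z/(e^z-1) = Σ B_n z^n/n!, i.e. B₀ = 1 and
-- Σ_{k=0}^{m} C(m+1,k) B_k = 0 for m ≥ 1, so
-- B_m = -(1/(m+1)) Σ_{k<m} C(m+1,k) B_k   (gives B₁ = -1/2).
-- bernTable m : function k ↦ B_k, valid for k ≤ m.
bernTable : ℕ → (ℕ → ℚ)
bernTable zero    = λ _ → 1ℚ
bernTable (suc m) = λ k → step k
  where
    prev : ℕ → ℚ
    prev = bernTable m
    new : ℚ
    new = - ((+ 1 / (suc (suc m))) *
             Σ< (suc m) (λ k → (+ (suc (suc m) C k) / 1) * prev k))
    step : ℕ → ℚ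
    step k with k ℕ.≤ᵇ m
    ... | Data.Bool.true  = prev k
    ... | Data.Bool.false = new

B : ℕ → ℚ
B n = bernTable n n

-- Read a sequence f as the power series Σ f_ν xᵛ and let δ = (x − 1) d/dx, a derivation.
-- The recurrence of ν! S₂(n,ν) turns Σ_ν (−1)ᵛ ν! S₂(n,ν) f_ν into the same sum for n − 1
-- and δf, so it is the constant term of δⁿf.  Here f = Σ H_ν xᵛ/(ν+1) = Lℓ/2 with
-- L = −log(1 − x) and ℓ = L/x.  The Leibniz rule gives
-- (δⁿ(Lℓ))(0) = Σ_k C(n,k) (δᵏL)(0) (δⁿ⁻ᵏℓ)(0), and since δL = −1 only k = 1 survives, so the
-- sum is −n (δⁿ⁻¹ℓ)(0)/2.  Finally b_k = (δᵏℓ)(0) are the Bernoulli numbers: Leibniz applied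
-- to L = xℓ, with δx = x − 1 and δ²L = 0, gives Σ_{k ≤ m} C(m+1,k) b_k = 0 for m ≥ 1.
module Submission where

open import Defs
open import Data.Nat using (ℕ; suc; _≥_; _∸_; _!)
import Data.Nat
open import Data.Integer using (+_)
open import Data.Rational using (ℚ; _*_; -_; _/_)
open import Relation.Binary.PropositionalEquality using (_≡_)

open import Data.Bool using (true; false)
open import Data.Nat as ℕ using (zero; _≤_; _<_; s≤s)
import Data.Nat.Properties as ℕₚ
open import Data.Nat.Combinatorics using (_C_; nCk+nC[k+1]≡[n+1]C[k+1]; nC1≡n; k>n⇒nCk≡0; nCk≡nC[n∸k])
import Data.Nat.Tactic.RingSolver as ℕ-Ring
import Data.Integer as ℤ
import Data.Integer.Properties as ℤₚ
open import Data.Rational using (0ℚ; 1ℚ; _+_; _-_; fromℚᵘ; toℚᵘ; _≟_)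
open import Data.Rational.Properties
  using ( +-identityˡ; +-identityʳ; *-identityˡ; *-identityʳ; *-zeroˡ; *-zeroʳ; *-comm
        ; *-distribˡ-+; *-distribʳ-+; +-comm; +-*-commutativeRing; toℚᵘ-homo-+; toℚᵘ-homo-*; toℚᵘ-fromℚᵘ
        ; fromℚᵘ-toℚᵘ; fromℚᵘ-cong )
import Data.Rational.Unnormalised as ℚᵘ
import Data.Rational.Unnormalised.Properties as ℚᵘₚ
open import Data.Sum using (inj₁; inj₂)
open import Function using (_∘_; const)
open import Level using (0ℓ)
open import Relation.Binary.PropositionalEquality using (_≗_; refl; sym; trans; cong; cong₂; module ≡-Reasoning)
open import Relation.Nullary.Decidable using (dec⇒maybe)
open import Tactic.RingSolver using (solve-∀)
open import Tactic.RingSolver.Core.AlmostCommutativeRing using (AlmostCommutativeRing; fromCommutativeRing)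

open ≡-Reasoning

ℚ-ring : AlmostCommutativeRing 0ℓ 0ℓ
ℚ-ring = fromCommutativeRing +-*-commutativeRing (λ p → dec⇒maybe (0ℚ ≟ p))

*-distribˡ-- : ∀ p q r → p * (q - r) ≡ p * q - p * r
*-distribˡ-- = solve-∀ ℚ-ring

*-distribʳ-- : ∀ p q r → (q - r) * p ≡ q * p - r * p
*-distribʳ-- = solve-∀ ℚ-ring

fromℚᵘ-homo-+ : ∀ p q → fromℚᵘ (p ℚᵘ.+ q) ≡ fromℚᵘ p + fromℚᵘ q
fromℚᵘ-homo-+ p q = begin
  fromℚᵘ (p ℚᵘ.+ q)
    ≡⟨ fromℚᵘ-cong (ℚᵘₚ.+-cong (ℚᵘₚ.≃-sym (toℚᵘ-fromℚᵘ p)) (ℚᵘₚ.≃-sym (toℚᵘ-fromℚᵘ q))) ⟩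
  fromℚᵘ (toℚᵘ (fromℚᵘ p) ℚᵘ.+ toℚᵘ (fromℚᵘ q))
    ≡⟨ fromℚᵘ-cong (ℚᵘₚ.≃-sym (toℚᵘ-homo-+ (fromℚᵘ p) (fromℚᵘ q))) ⟩
  fromℚᵘ (toℚᵘ (fromℚᵘ p + fromℚᵘ q))
    ≡⟨ fromℚᵘ-toℚᵘ _ ⟩
  fromℚᵘ p + fromℚᵘ q ∎

fromℚᵘ-homo-* : ∀ p q → fromℚᵘ (p ℚᵘ.* q) ≡ fromℚᵘ p * fromℚᵘ q
fromℚᵘ-homo-* p q = begin
  fromℚᵘ (p ℚᵘ.* q)
    ≡⟨ fromℚᵘ-cong (ℚᵘₚ.*-cong (ℚᵘₚ.≃-sym (toℚᵘ-fromℚᵘ p)) (ℚᵘₚ.≃-sym (toℚᵘ-fromℚᵘ q))) ⟩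
  fromℚᵘ (toℚᵘ (fromℚᵘ p) ℚᵘ.* toℚᵘ (fromℚᵘ q))
    ≡⟨ fromℚᵘ-cong (ℚᵘₚ.≃-sym (toℚᵘ-homo-* (fromℚᵘ p) (fromℚᵘ q))) ⟩
  fromℚᵘ (toℚᵘ (fromℚᵘ p * fromℚᵘ q))
    ≡⟨ fromℚᵘ-toℚᵘ _ ⟩
  fromℚᵘ p * fromℚᵘ q ∎

ιᵘ : ℕ → ℚᵘ.ℚᵘ
ιᵘ n = ℚᵘ.mkℚᵘ (+ n) 0

-- Definitionally + n / 1, as in the statement; the detour through ℚᵘ exposes the
-- integer arithmetic behind ι-+ and ι-*.
ι : ℕ → ℚ
ι n = fromℚᵘ (ιᵘ n)

ι-+ : ∀ m n → ι (m ℕ.+ n) ≡ ι m + ι n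
ι-+ m n = trans (fromℚᵘ-cong {ιᵘ (m ℕ.+ n)} {ιᵘ m ℚᵘ.+ ιᵘ n} (ℚᵘ.*≡* eq)) (fromℚᵘ-homo-+ (ιᵘ m) (ιᵘ n))
  where
  eq : + (m ℕ.+ n) ℤ.* + 1 ≡ (+ m ℤ.* + 1 ℤ.+ + n ℤ.* + 1) ℤ.* + 1
  eq = begin
    + (m ℕ.+ n) ℤ.* + 1             ≡⟨ ℤₚ.*-identityʳ _ ⟩
    + (m ℕ.+ n)                     ≡⟨ ℤₚ.pos-+ m n ⟩
    + m ℤ.+ + n                     ≡⟨ cong₂ ℤ._+_ (ℤₚ.*-identityʳ (+ m)) (ℤₚ.*-identityʳ (+ n)) ⟨
    + m ℤ.* + 1 ℤ.+ + n ℤ.* + 1     ≡⟨ ℤₚ.*-identityʳ _ ⟨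
    (+ m ℤ.* + 1 ℤ.+ + n ℤ.* + 1) ℤ.* + 1 ∎

ι-* : ∀ m n → ι (m ℕ.* n) ≡ ι m * ι n
ι-* m n = trans (fromℚᵘ-cong {ιᵘ (m ℕ.* n)} {ιᵘ m ℚᵘ.* ιᵘ n} (ℚᵘ.*≡* (cong (ℤ._* + 1) (ℤₚ.pos-* m n))))
                (fromℚᵘ-homo-* (ιᵘ m) (ιᵘ n))

ι-inverse : ∀ n → ι (suc n) * (+ 1 / suc n) ≡ 1ℚ
ι-inverse n = trans (sym (fromℚᵘ-homo-* (ιᵘ (suc n)) (ℚᵘ.mkℚᵘ (+ 1) n)))
                    (fromℚᵘ-cong {ιᵘ (suc n) ℚᵘ.* ℚᵘ.mkℚᵘ (+ 1) n} {ιᵘ 1} (ℚᵘ.*≡* eq))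
  where
  eq : (+ suc n ℤ.* + 1) ℤ.* + 1 ≡ + 1 ℤ.* + suc (ℕ.pred (1 ℕ.* suc n))
  eq = begin
    (+ suc n ℤ.* + 1) ℤ.* + 1      ≡⟨ trans (ℤₚ.*-identityʳ _) (ℤₚ.*-identityʳ _) ⟩
    + suc n                        ≡⟨ cong (λ k → + suc k) (ℕₚ.+-identityʳ n) ⟨
    + suc (ℕ.pred (1 ℕ.* suc n))   ≡⟨ ℤₚ.*-identityˡ _ ⟨
    + 1 ℤ.* + suc (ℕ.pred (1 ℕ.* suc n)) ∎

½ : ℚ
½ = + 1 / 2

n/2≡½*ι : ∀ n → + n / 2 ≡ ½ * ι n
n/2≡½*ι n = trans (fromℚᵘ-cong {ℚᵘ.mkℚᵘ (+ n) 1} {ℚᵘ.mkℚᵘ (+ 1) 1 ℚᵘ.* ιᵘ n} (ℚᵘ.*≡* eq)) (fromℚᵘ-homo-* (ℚᵘ.mkℚᵘ (+ 1) 1) (ιᵘ n))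
  where
  eq : + n ℤ.* + 2 ≡ (+ 1 ℤ.* + n) ℤ.* + 2
  eq = cong (ℤ._* + 2) (sym (ℤₚ.*-identityˡ (+ n)))

Σ<-cong : ∀ n {f g : ℕ → ℚ} → (∀ i → i < n → f i ≡ g i) → Σ< n f ≡ Σ< n g
Σ<-cong zero    f≡g = refl
Σ<-cong (suc n) f≡g = cong₂ _+_ (Σ<-cong n (λ i i<n → f≡g i (ℕₚ.m<n⇒m<1+n i<n))) (f≡g n (ℕₚ.n<1+n n))

Σ<-zero : ∀ n f → (∀ i → i < n → f i ≡ 0ℚ) → Σ< n f ≡ 0ℚ
Σ<-zero n f f≡0 = trans (Σ<-cong n f≡0) (Σ<-const0 n)
  where
  Σ<-const0 : ∀ n → Σ< n (const 0ℚ) ≡ 0ℚ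
  Σ<-const0 zero    = refl
  Σ<-const0 (suc n) = cong (_+ 0ℚ) (Σ<-const0 n)

Σ<-+ : ∀ n f g → Σ< n (λ i → f i + g i) ≡ Σ< n f + Σ< n g
Σ<-+ zero    f g = refl
Σ<-+ (suc n) f g = trans (cong (_+ (f n + g n)) (Σ<-+ n f g)) (interchange (Σ< n f) (Σ< n g) (f n) (g n))
  where
  interchange : ∀ a b c d → (a + b) + (c + d) ≡ (a + c) + (b + d)
  interchange = solve-∀ ℚ-ring

Σ<-neg : ∀ n f → Σ< n (λ i → - f i) ≡ - Σ< n f
Σ<-neg zero    f = refl
Σ<-neg (suc n) f = trans (cong (_+ (- f n)) (Σ<-neg n f)) (neg-+ (Σ< n f) (f n))
  where
  neg-+ : ∀ a b → - a + - b ≡ - (a + b)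
  neg-+ = solve-∀ ℚ-ring

Σ<-- : ∀ n f g → Σ< n (λ i → f i - g i) ≡ Σ< n f - Σ< n g
Σ<-- n f g = trans (Σ<-+ n f (λ i → - g i)) (cong (_+_ (Σ< n f)) (Σ<-neg n g))

*-distribˡ-Σ< : ∀ n c f → c * Σ< n f ≡ Σ< n (λ i → c * f i)
*-distribˡ-Σ< zero    c f = *-zeroʳ c
*-distribˡ-Σ< (suc n) c f = begin
  c * (Σ< n f + f n)     ≡⟨ *-distribˡ-+ c _ _ ⟩
  c * Σ< n f + c * f n   ≡⟨ cong (_+ c * f n) (*-distribˡ-Σ< n c f) ⟩
  Σ< (suc n) (λ i → c * f i) ∎

Σ<-head : ∀ n f → Σ< (suc n) f ≡ f 0 + Σ< n (f ∘ suc)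
Σ<-head zero    f = trans (+-identityˡ (f 0)) (sym (+-identityʳ (f 0)))
Σ<-head (suc n) f = trans (cong (_+ f (suc n)) (Σ<-head n f)) (+-assoc′ (f 0) (Σ< n (f ∘ suc)) (f (suc n)))
  where
  +-assoc′ : ∀ a b c → (a + b) + c ≡ a + (b + c)
  +-assoc′ = solve-∀ ℚ-ring

Σ<-shift : ∀ n f → f 0 ≡ 0ℚ → f n ≡ 0ℚ → Σ< n (f ∘ suc) ≡ Σ< n f
Σ<-shift zero    f f₀≡0 fₙ≡0 = refl
Σ<-shift (suc n) f f₀≡0 fₙ≡0 = begin
  Σ< n (f ∘ suc) + f (suc n)   ≡⟨ cong (_+_ (Σ< n (f ∘ suc))) fₙ≡0 ⟩
  Σ< n (f ∘ suc) + 0ℚ          ≡⟨ +-identityʳ _ ⟩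
  Σ< n (f ∘ suc)               ≡⟨ +-identityˡ _ ⟨
  0ℚ + Σ< n (f ∘ suc)          ≡⟨ cong (_+ Σ< n (f ∘ suc)) f₀≡0 ⟨
  f 0 + Σ< n (f ∘ suc)         ≡⟨ Σ<-head n f ⟨
  Σ< (suc n) f ∎

Σ<-reverse : ∀ n f → Σ< n f ≡ Σ< n (λ i → f (n ∸ suc i))
Σ<-reverse zero    f = refl
Σ<-reverse (suc n) f = begin
  Σ< n f + f n                           ≡⟨ cong (_+ f n) (Σ<-reverse n f) ⟩
  Σ< n (λ i → f (n ∸ suc i)) + f n       ≡⟨ +-comm (Σ< n (λ i → f (n ∸ suc i))) (f n) ⟩
  f n + Σ< n (λ i → f (n ∸ suc i))       ≡⟨ Σ<-head n (λ i → f (n ∸ i)) ⟨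
  Σ< (suc n) (λ i → f (suc n ∸ suc i)) ∎

-- Power series as coefficient sequences

Seq : Set
Seq = ℕ → ℚ

infixl 7 _⋆_ _⊛_
infix  8 x·_

_⋆_ : Seq → Seq → Seq
(f ⋆ g) ν = Σ< (suc ν) (λ i → f i * g (ν ∸ i))

𝟙 : Seq
𝟙 zero    = 1ℚ
𝟙 (suc _) = 0ℚ

x·_ : Seq → Seq
(x· f) zero    = 0ℚ
(x· f) (suc ν) = f ν

⋆-comm : ∀ f g → f ⋆ g ≗ g ⋆ f
⋆-comm f g ν = trans (Σ<-reverse (suc ν) _) (Σ<-cong (suc ν) swap)
  where
  swap : ∀ i → i < suc ν → f (ν ∸ i) * g (ν ∸ (ν ∸ i)) ≡ g i * f (ν ∸ i)
  swap i (s≤s i≤ν) = trans (cong (λ j → f (ν ∸ i) * g j) (ℕₚ.m∸[m∸n]≡n i≤ν)) (*-comm (f (ν ∸ i)) (g i))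

⋆-identityˡ : ∀ g → 𝟙 ⋆ g ≗ g
⋆-identityˡ g ν = begin
  (𝟙 ⋆ g) ν
    ≡⟨ Σ<-head ν _ ⟩
  1ℚ * g ν + Σ< ν (λ i → 0ℚ * g (ν ∸ suc i))
    ≡⟨ cong₂ _+_ (*-identityˡ (g ν)) (Σ<-zero ν _ (λ i _ → *-zeroˡ (g (ν ∸ suc i)))) ⟩
  g ν + 0ℚ
    ≡⟨ +-identityʳ (g ν) ⟩
  g ν ∎

⋆-distribʳ-- : ∀ f f′ g → (λ μ → f μ - f′ μ) ⋆ g ≗ (λ ν → (f ⋆ g) ν - (f′ ⋆ g) ν)
⋆-distribʳ-- f f′ g ν =
  trans (Σ<-cong (suc ν) (λ i _ → *-distribʳ-- (g (ν ∸ i)) (f i) (f′ i))) (Σ<-- (suc ν) _ _)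

⋆-distribˡ-- : ∀ f g g′ → f ⋆ (λ μ → g μ - g′ μ) ≗ (λ ν → (f ⋆ g) ν - (f ⋆ g′) ν)
⋆-distribˡ-- f g g′ ν =
  trans (Σ<-cong (suc ν) (λ i _ → *-distribˡ-- (f i) (g (ν ∸ i)) (g′ (ν ∸ i)))) (Σ<-- (suc ν) _ _)

⋆-shiftˡ : ∀ f g ν → f 0 ≡ 0ℚ → (f ⋆ g) (suc ν) ≡ ((f ∘ suc) ⋆ g) ν
⋆-shiftˡ f g ν f₀≡0 = begin
  (f ⋆ g) (suc ν)                          ≡⟨ Σ<-head (suc ν) _ ⟩
  f 0 * g (suc ν) + ((f ∘ suc) ⋆ g) ν      ≡⟨ cong (λ c → c * g (suc ν) + ((f ∘ suc) ⋆ g) ν) f₀≡0 ⟩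
  0ℚ * g (suc ν) + ((f ∘ suc) ⋆ g) ν       ≡⟨ cong (_+ ((f ∘ suc) ⋆ g) ν) (*-zeroˡ (g (suc ν))) ⟩
  0ℚ + ((f ∘ suc) ⋆ g) ν                   ≡⟨ +-identityˡ _ ⟩
  ((f ∘ suc) ⋆ g) ν ∎

x·-⋆ : ∀ f g → x· f ⋆ g ≗ x· (f ⋆ g)
x·-⋆ f g zero    = trans (+-identityˡ _) (*-zeroˡ (g 0))
x·-⋆ f g (suc ν) = ⋆-shiftˡ (x· f) g ν refl

-- The derivation δ = (x − 1) d/dx

θ ∂ δ : Seq → Seq
θ f ν = ι ν * f ν
∂ f ν = ι (suc ν) * f (suc ν)
δ f ν = θ f ν - ∂ f ν

θ-⋆ : ∀ f g → θ (f ⋆ g) ≗ (λ ν → (θ f ⋆ g) ν + (f ⋆ θ g) ν)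
θ-⋆ f g ν = begin
  ι ν * (f ⋆ g) ν
    ≡⟨ *-distribˡ-Σ< (suc ν) (ι ν) _ ⟩
  Σ< (suc ν) (λ i → ι ν * (f i * g (ν ∸ i)))
    ≡⟨ Σ<-cong (suc ν) (λ i i≤ν → trans (cong (_* (f i * g (ν ∸ i))) (ι-split i≤ν)) (leibniz (ι i) (ι (ν ∸ i)) (f i) (g (ν ∸ i)))) ⟩
  Σ< (suc ν) (λ i → θ f i * g (ν ∸ i) + f i * θ g (ν ∸ i))
    ≡⟨ Σ<-+ (suc ν) _ _ ⟩
  (θ f ⋆ g) ν + (f ⋆ θ g) ν ∎
  where
  ι-split : ∀ {i} → i < suc ν → ι ν ≡ ι i + ι (ν ∸ i)
  ι-split {i} (s≤s i≤ν) = trans (cong ι (sym (ℕₚ.m+[n∸m]≡n i≤ν))) (ι-+ i (ν ∸ i))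
  leibniz : ∀ x y F G → (x + y) * (F * G) ≡ x * F * G + F * (y * G)
  leibniz = solve-∀ ℚ-ring

∂-⋆ : ∀ f g → ∂ (f ⋆ g) ≗ (λ ν → (∂ f ⋆ g) ν + (f ⋆ ∂ g) ν)
∂-⋆ f g ν = begin
  θ (f ⋆ g) (suc ν)                          ≡⟨ θ-⋆ f g (suc ν) ⟩
  (θ f ⋆ g) (suc ν) + (f ⋆ θ g) (suc ν)      ≡⟨ cong (_+_ ((θ f ⋆ g) (suc ν))) (⋆-comm f (θ g) (suc ν)) ⟩
  (θ f ⋆ g) (suc ν) + (θ g ⋆ f) (suc ν)      ≡⟨ cong₂ _+_ (θ-shift f g) (θ-shift g f) ⟩
  (∂ f ⋆ g) ν + (∂ g ⋆ f) ν                  ≡⟨ cong (_+_ ((∂ f ⋆ g) ν)) (⋆-comm (∂ g) f ν) ⟩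
  (∂ f ⋆ g) ν + (f ⋆ ∂ g) ν ∎
  where
  θ-shift : ∀ f g → (θ f ⋆ g) (suc ν) ≡ (∂ f ⋆ g) ν
  θ-shift f g = ⋆-shiftˡ (θ f) g ν (*-zeroˡ (f 0))

δ-⋆ : ∀ f g → δ (f ⋆ g) ≗ (λ ν → (δ f ⋆ g) ν + (f ⋆ δ g) ν)
δ-⋆ f g ν = begin
  θ (f ⋆ g) ν - ∂ (f ⋆ g) ν
    ≡⟨ cong₂ _-_ (θ-⋆ f g ν) (∂-⋆ f g ν) ⟩
  ((θ f ⋆ g) ν + (f ⋆ θ g) ν) - ((∂ f ⋆ g) ν + (f ⋆ ∂ g) ν)
    ≡⟨ regroup ((θ f ⋆ g) ν) ((f ⋆ θ g) ν) ((∂ f ⋆ g) ν) ((f ⋆ ∂ g) ν) ⟩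
  ((θ f ⋆ g) ν - (∂ f ⋆ g) ν) + ((f ⋆ θ g) ν - (f ⋆ ∂ g) ν)
    ≡⟨ cong₂ _+_ (⋆-distribʳ-- (θ f) (∂ f) g ν) (⋆-distribˡ-- f (θ g) (∂ g) ν) ⟨
  (δ f ⋆ g) ν + (f ⋆ δ g) ν ∎
  where
  regroup : ∀ a b c d → (a + b) - (c + d) ≡ (a - c) + (b - d)
  regroup = solve-∀ ℚ-ring

δ-cong : ∀ {f g} → f ≗ g → δ f ≗ δ g
δ-cong f≗g ν = cong₂ _-_ (cong (ι ν *_) (f≗g ν)) (cong (ι (suc ν) *_) (f≗g (suc ν)))

δ^ : ℕ → Seq → Seq
δ^ zero    f = f
δ^ (suc n) f = δ^ n (δ f)

δ^-cong : ∀ n {f g} → f ≗ g → δ^ n f ≗ δ^ n g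
δ^-cong zero    f≗g = f≗g
δ^-cong (suc n) f≗g = δ^-cong n (δ-cong f≗g)

δ^-+ : ∀ n f g → δ^ n (λ μ → f μ + g μ) ≗ (λ ν → δ^ n f ν + δ^ n g ν)
δ^-+ zero    f g ν = refl
δ^-+ (suc n) f g ν = trans (δ^-cong n δ-+ ν) (δ^-+ n (δ f) (δ g) ν)
  where
  distrib : ∀ x y a b c d → x * (a + b) - y * (c + d) ≡ (x * a - y * c) + (x * b - y * d)
  distrib = solve-∀ ℚ-ring
  δ-+ : δ (λ μ → f μ + g μ) ≗ (λ μ → δ f μ + δ g μ)
  δ-+ μ = distrib (ι μ) (ι (suc μ)) (f μ) (g μ) (f (suc μ)) (g (suc μ))

δ^-scale : ∀ n c f → δ^ n (λ μ → c * f μ) ≗ (λ ν → c * δ^ n f ν)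
δ^-scale zero    c f ν = refl
δ^-scale (suc n) c f ν = trans (δ^-cong n δ-scale ν) (δ^-scale n c (δ f) ν)
  where
  distrib : ∀ c x y a b → x * (c * a) - y * (c * b) ≡ c * (x * a - y * b)
  distrib = solve-∀ ℚ-ring
  δ-scale : δ (λ μ → c * f μ) ≗ (λ μ → c * δ f μ)
  δ-scale μ = distrib c (ι μ) (ι (suc μ)) (f μ) (f (suc μ))

δ^-fixed : ∀ n {f} → δ f ≗ f → δ^ n f ≗ f
δ^-fixed zero    δf≗f = λ _ → refl
δ^-fixed (suc n) δf≗f ν = trans (δ^-cong n δf≗f ν) (δ^-fixed n δf≗f ν)

δ-zero : δ (const 0ℚ) ≗ const 0ℚ
δ-zero ν = cong₂ _-_ (*-zeroʳ (ι ν)) (*-zeroʳ (ι (suc ν)))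

δ₀ : Seq → Seq
δ₀ f n = δ^ n f 0

-- Leibniz rule for δⁿ at 0

_⊛_ : Seq → Seq → Seq
(a ⊛ b) n = Σ< (suc n) (λ k → ι (n C k) * a k * b (n ∸ k))

∸-suc : ∀ {n j} → j < n → n ∸ j ≡ suc (n ∸ suc j)
∸-suc {n} j<n = ℕₚ.+-∸-assoc 1 {n} j<n

⊛-pascal : ∀ a b n → (a ⊛ b) (suc n) ≡ ((a ∘ suc) ⊛ b) n + (a ⊛ (b ∘ suc)) n
⊛-pascal a b n = begin
  (a ⊛ b) (suc n)
    ≡⟨ Σ<-head (suc n) _ ⟩
  P₀ + Σ< (suc n) (λ j → ι (suc n C suc j) * a (suc j) * b (n ∸ j))
    ≡⟨ cong (_+_ P₀) (Σ<-cong (suc n) (λ j _ → split j)) ⟩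
  P₀ + Σ< (suc n) (λ j → A j + A′ j)
    ≡⟨ cong (_+_ P₀) (Σ<-+ (suc n) A A′) ⟩
  P₀ + (((a ∘ suc) ⊛ b) n + (Σ< n A′ + A′ n))
    ≡⟨ cong (λ t → P₀ + (((a ∘ suc) ⊛ b) n + (Σ< n A′ + t))) A′-top ⟩
  P₀ + (((a ∘ suc) ⊛ b) n + (Σ< n A′ + 0ℚ))
    ≡⟨ regroup P₀ (((a ∘ suc) ⊛ b) n) (Σ< n A′) ⟩
  ((a ∘ suc) ⊛ b) n + (P₀ + Σ< n A′)
    ≡⟨ cong (_+_ (((a ∘ suc) ⊛ b) n)) ⊛-suc ⟨
  ((a ∘ suc) ⊛ b) n + (a ⊛ (b ∘ suc)) n ∎
  where
  P₀ : ℚ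
  P₀ = ι 1 * a 0 * b (suc n)
  A A′ : Seq
  A  j = ι (n C j) * a (suc j) * b (n ∸ j)
  A′ j = ι (n C suc j) * a (suc j) * b (n ∸ j)
  split : ∀ j → ι (suc n C suc j) * a (suc j) * b (n ∸ j) ≡ A j + A′ j
  split j = begin
    ι (suc n C suc j) * a (suc j) * b (n ∸ j)
      ≡⟨ cong (λ c → ι c * a (suc j) * b (n ∸ j)) (nCk+nC[k+1]≡[n+1]C[k+1] n j) ⟨
    ι (n C j ℕ.+ n C suc j) * a (suc j) * b (n ∸ j)
      ≡⟨ cong (λ c → c * a (suc j) * b (n ∸ j)) (ι-+ (n C j) (n C suc j)) ⟩
    (ι (n C j) + ι (n C suc j)) * a (suc j) * b (n ∸ j)
      ≡⟨ cong (_* b (n ∸ j)) (*-distribʳ-+ (a (suc j)) (ι (n C j)) (ι (n C suc j))) ⟩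
    (ι (n C j) * a (suc j) + ι (n C suc j) * a (suc j)) * b (n ∸ j)
      ≡⟨ *-distribʳ-+ (b (n ∸ j)) (ι (n C j) * a (suc j)) (ι (n C suc j) * a (suc j)) ⟩
    A j + A′ j ∎
  A′-top : A′ n ≡ 0ℚ
  A′-top = begin
    ι (n C suc n) * a (suc n) * b (n ∸ n) ≡⟨ cong (λ c → ι c * a (suc n) * b (n ∸ n)) (k>n⇒nCk≡0 (ℕₚ.n<1+n n)) ⟩
    0ℚ * a (suc n) * b (n ∸ n)            ≡⟨ cong (_* b (n ∸ n)) (*-zeroˡ (a (suc n))) ⟩
    0ℚ * b (n ∸ n)                        ≡⟨ *-zeroˡ (b (n ∸ n)) ⟩
    0ℚ ∎
  regroup : ∀ p x s → p + (x + (s + 0ℚ)) ≡ x + (p + s)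
  regroup = solve-∀ ℚ-ring
  ⊛-suc : (a ⊛ (b ∘ suc)) n ≡ P₀ + Σ< n A′
  ⊛-suc = trans (Σ<-head n _) (cong (_+_ P₀) (Σ<-cong n (λ j j<n →
    cong (λ k → ι (n C suc j) * a (suc j) * b k) (sym (∸-suc j<n)))))

δ₀-⋆ : ∀ n f g → δ₀ (f ⋆ g) n ≡ (δ₀ f ⊛ δ₀ g) n
δ₀-⋆ zero    f g = cong (_+_ 0ℚ) (cong (_* g 0) (sym (*-identityˡ (f 0))))
δ₀-⋆ (suc n) f g = begin
  δ^ n (δ (f ⋆ g)) 0
    ≡⟨ δ^-cong n (δ-⋆ f g) 0 ⟩
  δ^ n (λ ν → (δ f ⋆ g) ν + (f ⋆ δ g) ν) 0
    ≡⟨ δ^-+ n (δ f ⋆ g) (f ⋆ δ g) 0 ⟩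
  δ₀ (δ f ⋆ g) n + δ₀ (f ⋆ δ g) n
    ≡⟨ cong₂ _+_ (δ₀-⋆ n (δ f) g) (δ₀-⋆ n f (δ g)) ⟩
  (δ₀ (δ f) ⊛ δ₀ g) n + (δ₀ f ⊛ δ₀ (δ g)) n
    ≡⟨ ⊛-pascal (δ₀ f) (δ₀ g) n ⟨
  (δ₀ f ⊛ δ₀ g) (suc n) ∎

n<k⇒S₂nk≡0 : ∀ {n k} → n < k → S₂ n k ≡ 0
n<k⇒S₂nk≡0 {zero}  {suc k} _ = refl
n<k⇒S₂nk≡0 {suc n} {suc k} (s≤s n<k)
  rewrite n<k⇒S₂nk≡0 (ℕₚ.m<n⇒m<1+n n<k) | n<k⇒S₂nk≡0 n<k = trans (ℕₚ.+-identityʳ (suc k ℕ.* 0)) (ℕₚ.*-zeroʳ (suc k))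

orderedS₂ : ℕ → ℕ → ℕ
orderedS₂ n ν = ν ! ℕ.* S₂ n ν

orderedS₂-suc : ∀ n j → orderedS₂ (suc n) (suc j) ≡ suc j ℕ.* (orderedS₂ n (suc j) ℕ.+ orderedS₂ n j)
orderedS₂-suc n j = regroup (suc j) (j !) (S₂ n (suc j)) (S₂ n j)
  where
  regroup : ∀ s p a b → (s ℕ.* p) ℕ.* (s ℕ.* a ℕ.+ b) ≡ s ℕ.* ((s ℕ.* p) ℕ.* a ℕ.+ p ℕ.* b)
  regroup = ℕ-Ring.solve-∀

signedOrderedS₂ : ℕ → ℕ → ℚ
signedOrderedS₂ n ν = ι (orderedS₂ n ν) * sgn ν

signedOrderedS₂-suc : ∀ n j →
  signedOrderedS₂ (suc n) (suc j) ≡ ι (suc j) * (signedOrderedS₂ n (suc j) - signedOrderedS₂ n j)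
signedOrderedS₂-suc n j = begin
  ι (orderedS₂ (suc n) (suc j)) * - sgn j
    ≡⟨ cong (λ k → ι k * - sgn j) (orderedS₂-suc n j) ⟩
  ι (suc j ℕ.* (orderedS₂ n (suc j) ℕ.+ orderedS₂ n j)) * - sgn j
    ≡⟨ cong (_* - sgn j) (ι-* (suc j) (orderedS₂ n (suc j) ℕ.+ orderedS₂ n j)) ⟩
  ι (suc j) * ι (orderedS₂ n (suc j) ℕ.+ orderedS₂ n j) * - sgn j
    ≡⟨ cong (λ t → ι (suc j) * t * - sgn j) (ι-+ (orderedS₂ n (suc j)) (orderedS₂ n j)) ⟩
  ι (suc j) * (ι (orderedS₂ n (suc j)) + ι (orderedS₂ n j)) * - sgn j
    ≡⟨ distrib (ι (suc j)) (ι (orderedS₂ n (suc j))) (ι (orderedS₂ n j)) (sgn j) ⟩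
  ι (suc j) * (ι (orderedS₂ n (suc j)) * - sgn j - ι (orderedS₂ n j) * sgn j) ∎
  where
  distrib : ∀ x a b s → x * (a + b) * - s ≡ x * (a * - s - b * s)
  distrib = solve-∀ ℚ-ring

stirlingTransform : ℕ → Seq → ℚ
stirlingTransform n f = Σ< (suc n) (λ ν → signedOrderedS₂ n ν * f ν)

stirlingTransform-suc : ∀ n f → stirlingTransform (suc n) f ≡ stirlingTransform n (δ f)
stirlingTransform-suc n f = begin
  Σ< (suc (suc n)) (λ ν → c (suc n) ν * f ν)
    ≡⟨ Σ<-head (suc n) _ ⟩
  0ℚ * f 0 + Σ< (suc n) (λ j → c (suc n) (suc j) * f (suc j))
    ≡⟨ cong₂ _+_ (*-zeroˡ (f 0)) (Σ<-cong (suc n) (λ j _ → step j)) ⟩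
  0ℚ + Σ< (suc n) (λ j → R (suc j) - Q j)
    ≡⟨ +-identityˡ _ ⟩
  Σ< (suc n) (λ j → R (suc j) - Q j)
    ≡⟨ Σ<-- (suc n) (R ∘ suc) Q ⟩
  Σ< (suc n) (R ∘ suc) - Σ< (suc n) Q
    ≡⟨ cong (_- Σ< (suc n) Q) (Σ<-shift (suc n) R R₀ R-top) ⟩
  Σ< (suc n) R - Σ< (suc n) Q
    ≡⟨ Σ<-- (suc n) R Q ⟨
  Σ< (suc n) (λ ν → R ν - Q ν)
    ≡⟨ Σ<-cong (suc n) (λ ν _ → *-distribˡ-- (c n ν) (θ f ν) (∂ f ν)) ⟨
  stirlingTransform n (δ f) ∎
  where
  c : ℕ → ℕ → ℚ
  c = signedOrderedS₂
  R Q : Seq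
  R ν = c n ν * θ f ν
  Q ν = c n ν * ∂ f ν
  step : ∀ j → c (suc n) (suc j) * f (suc j) ≡ R (suc j) - Q j
  step j = trans (cong (_* f (suc j)) (signedOrderedS₂-suc n j)) (distrib (ι (suc j)) (c n (suc j)) (c n j) (f (suc j)))
    where
    distrib : ∀ x p q y → x * (p - q) * y ≡ p * (x * y) - q * (x * y)
    distrib = solve-∀ ℚ-ring
  R₀ : R 0 ≡ 0ℚ
  R₀ = trans (cong (c n 0 *_) (*-zeroˡ (f 0))) (*-zeroʳ (c n 0))
  R-top : R (suc n) ≡ 0ℚ
  R-top = begin
    ι (orderedS₂ n (suc n)) * sgn (suc n) * θ f (suc n)
      ≡⟨ cong (λ k → ι k * sgn (suc n) * θ f (suc n)) (cong (suc n ! ℕ.*_) (n<k⇒S₂nk≡0 (ℕₚ.n<1+n n))) ⟩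
    ι (suc n ! ℕ.* 0) * sgn (suc n) * θ f (suc n)
      ≡⟨ cong (λ k → ι k * sgn (suc n) * θ f (suc n)) (ℕₚ.*-zeroʳ (suc n !)) ⟩
    0ℚ * sgn (suc n) * θ f (suc n)
      ≡⟨ trans (cong (_* θ f (suc n)) (*-zeroˡ (sgn (suc n)))) (*-zeroˡ (θ f (suc n))) ⟩
    0ℚ ∎

stirlingTransform≡δ₀ : ∀ n f → stirlingTransform n f ≡ δ₀ f n
stirlingTransform≡δ₀ zero    f = trans (+-identityˡ _) (*-identityˡ (f 0))
stirlingTransform≡δ₀ (suc n) f = trans (stirlingTransform-suc n f) (stirlingTransform≡δ₀ n (δ f))

-- Logarithms: L = −log(1 − x) and ℓ = L/x

ℓ : Seq
ℓ ν = + 1 / suc ν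

L : Seq
L = x· ℓ

X : Seq
X = x· 𝟙

L≗X⋆ℓ : L ≗ X ⋆ ℓ
L≗X⋆ℓ zero    = sym (x·-⋆ 𝟙 ℓ 0)
L≗X⋆ℓ (suc ν) = trans (sym (⋆-identityˡ ℓ ν)) (sym (x·-⋆ 𝟙 ℓ (suc ν)))

L⋆L-suc : ∀ ν → (L ⋆ L) (suc ν) ≡ (L ⋆ ℓ) ν
L⋆L-suc ν = begin
  (L ⋆ L) (suc ν)   ≡⟨ ⋆-comm L L (suc ν) ⟩
  (x· ℓ ⋆ L) (suc ν) ≡⟨ x·-⋆ ℓ L (suc ν) ⟩
  (ℓ ⋆ L) ν          ≡⟨ ⋆-comm ℓ L ν ⟩
  (L ⋆ ℓ) ν ∎

⋆-const1 : ∀ f ν → (f ⋆ const 1ℚ) ν ≡ Σ< (suc ν) f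
⋆-const1 f ν = Σ<-cong (suc ν) (λ i _ → *-identityʳ (f i))

ΣL≡H : ∀ ν → Σ< (suc ν) L ≡ H ν
ΣL≡H zero    = refl
ΣL≡H (suc ν) = cong (_+ ℓ ν) (ΣL≡H ν)

∂L≗1 : ∂ L ≗ const 1ℚ
∂L≗1 = ι-inverse

-- d/dx (L²) = 2 L/(1 − x) = 2 Σ H_ν xᵛ.
[1+ν]*L⋆ℓ≡2H : ∀ ν → ι (suc ν) * (L ⋆ ℓ) ν ≡ ι 2 * H ν
[1+ν]*L⋆ℓ≡2H ν = begin
  ι (suc ν) * (L ⋆ ℓ) ν
    ≡⟨ cong (ι (suc ν) *_) (L⋆L-suc ν) ⟨
  ∂ (L ⋆ L) ν
    ≡⟨ ∂-⋆ L L ν ⟩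
  (∂ L ⋆ L) ν + (L ⋆ ∂ L) ν
    ≡⟨ cong₂ _+_ (trans (⋆-comm (∂ L) L ν) (∂L-factor ν)) (∂L-factor ν) ⟩
  H ν + H ν
    ≡⟨ double (H ν) ⟩
  ι 2 * H ν ∎
  where
  ∂L-factor : ∀ ν → (L ⋆ ∂ L) ν ≡ H ν
  ∂L-factor ν = trans (Σ<-cong (suc ν) (λ i _ → cong (L i *_) (∂L≗1 (ν ∸ i))))
                      (trans (⋆-const1 L ν) (ΣL≡H ν))
  double : ∀ h → h + h ≡ ι 2 * h
  double = solve-∀ ℚ-ring

H*ℓ≡½L⋆ℓ : ∀ ν → H ν * ℓ ν ≡ ½ * (L ⋆ ℓ) ν
H*ℓ≡½L⋆ℓ ν = begin
  H ν * ℓ ν                            ≡⟨ halve (H ν) (ℓ ν) ⟩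
  ½ * (ι 2 * H ν) * ℓ ν                ≡⟨ cong (λ t → ½ * t * ℓ ν) ([1+ν]*L⋆ℓ≡2H ν) ⟨
  ½ * (ι (suc ν) * (L ⋆ ℓ) ν) * ℓ ν    ≡⟨ regroup (ι (suc ν)) ((L ⋆ ℓ) ν) (ℓ ν) ⟩
  ½ * (L ⋆ ℓ) ν * (ι (suc ν) * ℓ ν)    ≡⟨ cong (½ * (L ⋆ ℓ) ν *_) (ι-inverse ν) ⟩
  ½ * (L ⋆ ℓ) ν * 1ℚ                   ≡⟨ *-identityʳ _ ⟩
  ½ * (L ⋆ ℓ) ν ∎
  where
  halve : ∀ h l → h * l ≡ ½ * (ι 2 * h) * l
  halve = solve-∀ ℚ-ring
  regroup : ∀ x y l → ½ * (x * y) * l ≡ ½ * y * (x * l)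
  regroup = solve-∀ ℚ-ring

δL≗-𝟙 : δ L ≗ (λ ν → - 𝟙 ν)
δL≗-𝟙 zero    = refl
δL≗-𝟙 (suc ν) = cong₂ _-_ (ι-inverse ν) (ι-inverse (suc ν))

δ₀L[2+k]≡0 : ∀ k → δ₀ L (suc (suc k)) ≡ 0ℚ
δ₀L[2+k]≡0 k = trans (δ^-cong k (λ ν → trans (δ-cong δL≗-𝟙 ν) (δ-𝟙 ν)) 0) (δ^-fixed k δ-zero 0)
  where
  δ-𝟙 : δ (λ ν → - 𝟙 ν) ≗ const 0ℚ
  δ-𝟙 zero    = refl
  δ-𝟙 (suc ν) = δ-zero (suc ν)

δ₀L-⊛ : ∀ g m → (δ₀ L ⊛ g) (suc m) ≡ - (ι (suc m) * g m)
δ₀L-⊛ g m = begin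
  (δ₀ L ⊛ g) (suc m)
    ≡⟨ Σ<-head (suc m) _ ⟩
  0ℚ * g (suc m) + Σ< (suc m) (λ k → ι (suc m C suc k) * δ₀ L (suc k) * g (m ∸ k))
    ≡⟨ cong₂ _+_ (*-zeroˡ (g (suc m))) (Σ<-head m _) ⟩
  0ℚ + (ι (suc m C 1) * - 1ℚ * g m + Σ< m rest)
    ≡⟨ cong (λ t → 0ℚ + (ι (suc m C 1) * - 1ℚ * g m + t)) (Σ<-zero m rest rest≡0) ⟩
  0ℚ + (ι (suc m C 1) * - 1ℚ * g m + 0ℚ)
    ≡⟨ cong (λ c → 0ℚ + (ι c * - 1ℚ * g m + 0ℚ)) (nC1≡n (suc m)) ⟩
  0ℚ + (ι (suc m) * - 1ℚ * g m + 0ℚ)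
    ≡⟨ simplify (ι (suc m)) (g m) ⟩
  - (ι (suc m) * g m) ∎
  where
  rest : Seq
  rest k = ι (suc m C suc (suc k)) * δ₀ L (suc (suc k)) * g (m ∸ suc k)
  rest≡0 : ∀ k → k < m → rest k ≡ 0ℚ
  rest≡0 k _ = trans (cong (λ t → ι (suc m C suc (suc k)) * t * g (m ∸ suc k)) (δ₀L[2+k]≡0 k))
                     (trans (cong (_* g (m ∸ suc k)) (*-zeroʳ (ι (suc m C suc (suc k))))) (*-zeroˡ (g (m ∸ suc k))))
  simplify : ∀ x y → 0ℚ + (x * - 1ℚ * y + 0ℚ) ≡ - (x * y)
  simplify = solve-∀ ℚ-ring

-- Bernoulli numbers

β : Seq
β = δ₀ ℓ

δX≗X-𝟙 : δ X ≗ (λ ν → X ν - 𝟙 ν)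
δX≗X-𝟙 zero          = refl
δX≗X-𝟙 (suc zero)    = refl
δX≗X-𝟙 (suc (suc ν)) = δ-zero (suc (suc ν))

δ[X-𝟙]≗X-𝟙 : δ (λ ν → X ν - 𝟙 ν) ≗ (λ ν → X ν - 𝟙 ν)
δ[X-𝟙]≗X-𝟙 zero          = refl
δ[X-𝟙]≗X-𝟙 (suc zero)    = refl
δ[X-𝟙]≗X-𝟙 (suc (suc ν)) = δ-zero (suc (suc ν))

δ₀X-suc : ∀ k → δ₀ X (suc k) ≡ - 1ℚ
δ₀X-suc k = trans (δ^-cong k δX≗X-𝟙 0) (δ^-fixed k δ[X-𝟙]≗X-𝟙 0)

⊛-δ₀X : ∀ a n → (a ⊛ δ₀ X) n ≡ - Σ< n (λ k → ι (n C k) * a k)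
⊛-δ₀X a n = begin
  Σ< n (λ k → ι (n C k) * a k * δ₀ X (n ∸ k)) + ι (n C n) * a n * δ₀ X (n ∸ n)
    ≡⟨ cong₂ _+_ (Σ<-cong n (λ k k<n → times-1 k (∸-suc k<n))) top ⟩
  Σ< n (λ k → - (ι (n C k) * a k)) + 0ℚ
    ≡⟨ +-identityʳ _ ⟩
  Σ< n (λ k → - (ι (n C k) * a k))
    ≡⟨ Σ<-neg n _ ⟩
  - Σ< n (λ k → ι (n C k) * a k) ∎
  where
  times-1 : ∀ k {j} → n ∸ k ≡ suc j → ι (n C k) * a k * δ₀ X (n ∸ k) ≡ - (ι (n C k) * a k)
  times-1 k {j} eq = begin
    ι (n C k) * a k * δ₀ X (n ∸ k)    ≡⟨ cong (λ i → ι (n C k) * a k * δ₀ X i) eq ⟩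
    ι (n C k) * a k * δ₀ X (suc j)    ≡⟨ cong (ι (n C k) * a k *_) (δ₀X-suc j) ⟩
    ι (n C k) * a k * - 1ℚ            ≡⟨ *-1 _ ⟩
    - (ι (n C k) * a k) ∎
    where
    *-1 : ∀ x → x * - 1ℚ ≡ - x
    *-1 = solve-∀ ℚ-ring
  top : ι (n C n) * a n * δ₀ X (n ∸ n) ≡ 0ℚ
  top = trans (cong (λ i → ι (n C n) * a n * δ₀ X i) (ℕₚ.n∸n≡0 n)) (*-zeroʳ (ι (n C n) * a n))

β-recurrence : ∀ m → Σ< (suc (suc m)) (λ k → ι (suc (suc m) C k) * β k) ≡ 0ℚ
β-recurrence m = begin
  S                      ≡⟨ neg-involutive S ⟩
  - - S                  ≡⟨ cong -_ (⊛-δ₀X β (suc (suc m))) ⟨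
  - (β ⊛ δ₀ X) (suc (suc m))
    ≡⟨ cong -_ (δ₀-⋆ (suc (suc m)) ℓ X) ⟨
  - δ₀ (ℓ ⋆ X) (suc (suc m))
    ≡⟨ cong -_ (δ^-cong (suc (suc m)) (λ ν → trans (⋆-comm ℓ X ν) (sym (L≗X⋆ℓ ν))) 0) ⟩
  - δ₀ L (suc (suc m))   ≡⟨ cong -_ (δ₀L[2+k]≡0 m) ⟩
  0ℚ ∎
  where
  S : ℚ
  S = Σ< (suc (suc m)) (λ k → ι (suc (suc m) C k) * β k)
  neg-involutive : ∀ p → p ≡ - - p
  neg-involutive = solve-∀ ℚ-ring

β-suc : ∀ m → β (suc m) ≡ - ((+ 1 / suc (suc m)) * Σ< (suc m) (λ k → ι (suc (suc m) C k) * β k))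
β-suc m = isolate (ι (suc (suc m))) (+ 1 / suc (suc m)) S (β (suc m)) (ι-inverse (suc m))
  (trans (cong (λ c → S + ι c * β (suc m)) (sym [2+m]C[1+m]≡2+m)) (β-recurrence m))
  where
  S : ℚ
  S = Σ< (suc m) (λ k → ι (suc (suc m) C k) * β k)
  [2+m]C[1+m]≡2+m : suc (suc m) C suc m ≡ suc (suc m)
  [2+m]C[1+m]≡2+m = trans (nCk≡nC[n∸k] (ℕₚ.n≤1+n (suc m)))
    (trans (cong (suc (suc m) C_) (ℕₚ.m+n∸n≡m 1 (suc m))) (nC1≡n (suc (suc m))))
  isolate : ∀ c l s b → c * l ≡ 1ℚ → s + c * b ≡ 0ℚ → b ≡ - (l * s)
  isolate c l s b cl≡1 s+cb≡0 = begin
    b                        ≡⟨ *-identityʳ b ⟨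
    b * 1ℚ                   ≡⟨ cong (b *_) cl≡1 ⟨
    b * (c * l)              ≡⟨ expand c l s b ⟩
    l * (s + c * b) - l * s  ≡⟨ cong (λ t → l * t - l * s) s+cb≡0 ⟩
    l * 0ℚ - l * s           ≡⟨ collapse l s ⟩
    - (l * s) ∎
    where
    expand : ∀ c l s b → b * (c * l) ≡ l * (s + c * b) - l * s
    expand = solve-∀ ℚ-ring
    collapse : ∀ l s → l * 0ℚ - l * s ≡ - (l * s)
    collapse = solve-∀ ℚ-ring

n<ᵇn≡false : ∀ n → (n ℕ.<ᵇ n) ≡ false
n<ᵇn≡false zero    = refl
n<ᵇn≡false (suc n) = n<ᵇn≡false n

bernTable-stable : ∀ m k → k ≤ m → bernTable (suc m) k ≡ bernTable m k
bernTable-stable m k k≤m with k ℕ.≤ᵇ m | ℕₚ.≤⇒≤ᵇ k≤m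
... | true | _ = refl

bernTable-top : ∀ m → bernTable (suc m) (suc m)
  ≡ - ((+ 1 / suc (suc m)) * Σ< (suc m) (λ k → ι (suc (suc m) C k) * bernTable m k))
bernTable-top m rewrite n<ᵇn≡false m = refl

bernTable≡β : ∀ m k → k ≤ m → bernTable m k ≡ β k
bernTable≡β zero    zero    _ = refl
bernTable≡β (suc m) k k≤1+m with ℕₚ.m≤n⇒m<n∨m≡n k≤1+m
... | inj₁ (s≤s k≤m) = trans (bernTable-stable m k k≤m) (bernTable≡β m k k≤m)
... | inj₂ refl      = begin
  bernTable (suc m) (suc m)
    ≡⟨ bernTable-top m ⟩
  - ((+ 1 / suc (suc m)) * Σ< (suc m) (λ k → ι (suc (suc m) C k) * bernTable m k))
    ≡⟨ cong (λ s → - ((+ 1 / suc (suc m)) * s))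
            (Σ<-cong (suc m) (λ i i<1+m → cong (ι (suc (suc m) C i) *_) (bernTable≡β m i (ℕₚ.≤-pred i<1+m)))) ⟩
  - ((+ 1 / suc (suc m)) * Σ< (suc m) (λ k → ι (suc (suc m) C k) * β k))
    ≡⟨ β-suc m ⟨
  β (suc m) ∎

B≡β : ∀ n → B n ≡ β n
B≡β n = bernTable≡β n n ℕₚ.≤-refl

proposition3p1 : (n : ℕ) → n ≥ 1 →
    Σ[ 1 ⋯ n ] (λ ν → (+ ((ν !) Data.Nat.* S₂ n ν) / 1) * H ν * sgn ν * (+ 1 / suc ν))
      ≡ - ((+ n / 2) * B (n ∸ 1))
proposition3p1 (suc m) _ = begin
  Σ< (suc m) (λ j → ι (orderedS₂ (suc m) (suc j)) * H (suc j) * sgn (suc j) * ℓ (suc j))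
    ≡⟨ as-stirlingTransform ⟩
  stirlingTransform (suc m) (λ ν → H ν * ℓ ν)
    ≡⟨ stirlingTransform≡δ₀ (suc m) _ ⟩
  δ₀ (λ ν → H ν * ℓ ν) (suc m)
    ≡⟨ δ^-cong (suc m) H*ℓ≡½L⋆ℓ 0 ⟩
  δ₀ (λ ν → ½ * (L ⋆ ℓ) ν) (suc m)
    ≡⟨ δ^-scale (suc m) ½ (L ⋆ ℓ) 0 ⟩
  ½ * δ₀ (L ⋆ ℓ) (suc m)
    ≡⟨ cong (½ *_) (trans (δ₀-⋆ (suc m) L ℓ) (δ₀L-⊛ β m)) ⟩
  ½ * - (ι (suc m) * β m)
    ≡⟨ cong (λ b → ½ * - (ι (suc m) * b)) (B≡β m) ⟨
  ½ * - (ι (suc m) * B m)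
    ≡⟨ regroup ½ (ι (suc m)) (B m) ⟩
  - (½ * ι (suc m) * B m)
    ≡⟨ cong (λ h → - (h * B m)) (n/2≡½*ι (suc m)) ⟨
  - ((+ suc m / 2) * B m) ∎
  where
  regroup : ∀ h x b → h * - (x * b) ≡ - (h * x * b)
  regroup = solve-∀ ℚ-ring
  reorder : ∀ x h s l → x * h * s * l ≡ x * s * (h * l)
  reorder = solve-∀ ℚ-ring
  as-stirlingTransform :
    Σ< (suc m) (λ j → ι (orderedS₂ (suc m) (suc j)) * H (suc j) * sgn (suc j) * ℓ (suc j))
      ≡ stirlingTransform (suc m) (λ ν → H ν * ℓ ν)
  -- The ν = 0 summand vanishes by computation, since H 0 = 0.
  as-stirlingTransform = sym (trans (Σ<-head (suc m) _) (trans (+-identityˡ _)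
    (Σ<-cong (suc m) (λ j _ → sym (reorder (ι (orderedS₂ (suc m) (suc j))) (H (suc j)) (sgn (suc j)) (ℓ (suc j)))))))
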